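{- Let $q$ be a prime power, $m$ a positive integer, $s$ a positive integer and $k=2s+1$. Let $S$ and $T$ be $\mathbb{F}_q$-subspaces of $\mathbb{F}_{q^m}$ of dimension $m-2$ such that there exist no $\alpha\in\mathbb{F}_{q^m}$ and no field automorphism $\sigma$ of $\mathbb{F}_{q^m}$ with $S=\alpha T^\sigma$. Let \[U=\{(\eta,x_1,x_1^q,x_2,x_2^q,\ldots,x_s,x_s^q) : x_1,\ldots,x_s\in\mathbb{F}_{q^m},\ \eta\in S\},\] \[\bar U=\{(x_1+\zeta,x_1^q,x_1^{q^2},x_2,x_2^q,\ldots,x_s,x_s^q) : x_1,\ldots,x_s\in\mathbb{F}_{q^m},\ \zeta\in T\}.\] Then $U$ and $\bar U$ are $\Gamma\mathrm{L}(k,q^m)$-inequivalent. -}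

module Defs where

open import Level using (0ℓ)
open import Data.Nat as ℕ using (ℕ; zero; suc; _≤_)
open import Data.Nat.Primality using (Prime)
open import Data.Fin using (Fin; zero; suc)
open import Data.Vec using (Vec; []; _∷_; map; zipWith; replicate)
open import Data.Product using (Σ; ∃; ∃-syntax; _×_; _,_)
open import Function.Bundles using (_↔_; Inverse)
open import Relation.Nullary using (¬_)
open import Relation.Binary.PropositionalEquality using (_≡_)
open import Algebra.Core using (Op₁; Op₂)
open import Algebra.Structures using (IsCommutativeRing)

IsPrimePower : ℕ → Set
IsPrimePower q = Σ ℕ λ p → Σ ℕ λ e → Prime p × 1 ≤ e × q ≡ p ℕ.^ e

record Field : Set₁ where
  infixl 6 _+_
  infixl 7 _*_
  field
    Carrier : Set
    _+_ _*_ : Op₂ Carrier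
    -_ : Op₁ Carrier
    0# 1# : Carrier
    isCommutativeRing : IsCommutativeRing _≡_ _+_ _*_ -_ 0# 1#
    0≢1 : ¬ (0# ≡ 1#)
    inverse : ∀ x → ¬ (x ≡ 0#) → ∃[ y ] (x * y ≡ 1#)

double : ℕ → ℕ
double zero = zero
double (suc n) = suc (suc (double n))

module FieldDefs (F : Field) where
  open Field F

  _^_ : Carrier → ℕ → Carrier
  x ^ zero = 1#
  x ^ suc n = x * (x ^ n)

  HasCardinality : ℕ → Set
  HasCardinality n = Carrier ↔ Fin n

  -- the subfield F_q = { x | x^q = x } (for |F| = q^m this is the subfield of order q)
  InFq : ℕ → Carrier → Set
  InFq q x = x ^ q ≡ x

  sumF : ∀ {d} → (Fin d → Carrier) → Carrier
  sumF {zero} f = 0#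
  sumF {suc d} f = f zero + sumF (λ i → f (suc i))

  record IsSubspace (q : ℕ) (S : Carrier → Set) : Set where
    field
      zero∈ : S 0#
      +-closed : ∀ {x y} → S x → S y → S (x + y)
      scale-closed : ∀ {c x} → InFq q c → S x → S (c * x)

  HasDimension : ℕ → (Carrier → Set) → ℕ → Set
  HasDimension q S d = Σ (Fin d → Carrier) λ b →
      (∀ i → S (b i))
    × (∀ (c : Fin d → Carrier) → (∀ i → InFq q (c i)) →
         sumF (λ i → c i * b i) ≡ 0# → ∀ i → c i ≡ 0#)
    × (∀ x → S x → Σ (Fin d → Carrier) λ c →
         (∀ i → InFq q (c i)) × sumF (λ i → c i * b i) ≡ x)

  record Automorphism : Set where
    field
      bij : Carrier ↔ Carrier
    open Inverse bij public using (to)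
    field
      to-+ : ∀ x y → to (x + y) ≡ to x + to y
      to-* : ∀ x y → to (x * y) ≡ to x * to y
      to-1 : to 1# ≡ 1#

  IsImageOf : (Carrier → Set) → Carrier → Automorphism → (Carrier → Set) → Set
  IsImageOf S α σ T =
    ∀ x → (S x → ∃[ t ] (T t × x ≡ α * Automorphism.to σ t))
        × (∃[ t ] (T t × x ≡ α * Automorphism.to σ t) → S x)

  frobPairs : (q s : ℕ) → (Fin s → Carrier) → Vec Carrier (double s)
  frobPairs q zero x = []
  frobPairs q (suc s) x = x zero ∷ (x zero ^ q) ∷ frobPairs q s (λ i → x (suc i))

  uVec : (q s : ℕ) → Carrier → (Fin s → Carrier) → Vec Carrier (suc (double s))
  uVec q s η x = η ∷ frobPairs q s x

  uBarVec : (q s : ℕ) → 1 ≤ s → Carrier → (Fin s → Carrier) → Vec Carrier (suc (double s))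
  uBarVec q (suc s) _ ζ x =
    (x zero + ζ) ∷ (x zero ^ q) ∷ (x zero ^ (q ℕ.^ 2)) ∷ frobPairs q s (λ i → x (suc i))

  U : (q s : ℕ) → (Carrier → Set) → Vec Carrier (suc (double s)) → Set
  U q s S v = ∃[ η ] Σ (Fin s → Carrier) λ x → S η × v ≡ uVec q s η x

  UBar : (q s : ℕ) → 1 ≤ s → (Carrier → Set) → Vec Carrier (suc (double s)) → Set
  UBar q s s≥1 T v = ∃[ ζ ] Σ (Fin s → Carrier) λ x → T ζ × v ≡ uBarVec q s s≥1 ζ x

  record SemilinearBijection (k : ℕ) : Set where
    field
      σ : Automorphism
      bij : Vec Carrier k ↔ Vec Carrier k
    open Inverse bij public using (to)
    field
      additive : ∀ u v → to (zipWith _+_ u v) ≡ zipWith _+_ (to u) (to v)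
      semilinear : ∀ (λ' : Carrier) v →
        to (map (λ' *_) v) ≡ map (Automorphism.to σ λ' *_) (to v)

  ΓL-Equivalent : (k : ℕ) → (Vec Carrier k → Set) → (Vec Carrier k → Set) → Set
  ΓL-Equivalent k A B = Σ (SemilinearBijection k) λ φ →
    ∀ w → (B w → ∃[ v ] (A v × w ≡ SemilinearBijection.to φ v))
        × (∃[ v ] (A v × w ≡ SemilinearBijection.to φ v) → B w)

{-# OPTIONS --safe #-}
-- Let φ be a σ-semilinear bijection mapping U onto Ū, and let axis η = (η, 0, …, 0), which lies in
-- U for η ∈ S; semilinearity gives φ(axis (r η)) = σ(r) · φ(axis η). Fix b ≠ 0 in S and write
-- φ(axis b) = (x₁ + ζ₀, x₁^q, x₁^(q²), x₂, x₂^q, …) ∈ Ū. If some xⱼ ≠ 0, then for every η ∈ S the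
-- vector φ(axis η) = σ(η/b) · φ(axis b) has the same shape, which forces σ(η/b)^q = σ(η/b); hence
-- η/b ∈ F_q and S ⊆ F_q b, contradicting dim S = m − 2 ≥ 2 (the dependence (η/b) b − η = 0 needs
-- −1 ∈ F_q, which for even q holds because F then has characteristic 2). If all xⱼ = 0, then
-- φ(axis η) = (σ(η) c, 0, …, 0) with c = σ(b⁻¹) ζ₀ ≠ 0, and reading off first coordinates gives
-- S = α T^(σ⁻¹) with α = σ⁻¹(c⁻¹). For m − 2 ≤ 1 the non-similarity hypothesis is itself
-- contradictory: S and T are then both {0}, or both of the form F_q b.
module Submission where

open import Defs
open import Level using (0ℓ)
open import Algebra.Bundles using (CommutativeRing)
open import Algebra.Core using (Op₂)
open import Algebra.Structures using (IsCommutativeRing)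
open import Data.Nat using (ℕ; zero; suc; z≤n; s≤s; _≤_; _∸_; NonZero; parity)
import Data.Nat as ℕ
import Data.Nat.Properties as ℕ
open import Data.Nat.Divisibility using (_∣_; divides)
open import Data.Nat.Primality using (Prime; prime⇒irreducible; prime⇒nonZero)
open import Data.Parity.Base as ℙ using (0ℙ; 1ℙ)
import Data.Parity.Properties as ℙ
open import Data.Fin as Fin using (Fin; zero; suc)
open import Data.Fin.Properties using (all?; ¬∀⟶∃¬)
open import Data.Product using (Σ-syntax; ∃-syntax; _×_; _,_; proj₁; proj₂)
open import Data.Sum using (_⊎_; inj₁; inj₂)
open import Data.Vec using (Vec; _∷_; map)
open import Data.Vec.Properties using (∷-injectiveˡ; ∷-injectiveʳ)
open import Function.Base using (_∘_)
open import Function.Bundles using (_↔_; Inverse; Injection; mk↔ₛ′)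
open import Function.Construct.Composition using (_↔-∘_)
open import Function.Construct.Identity using (↔-id)
open import Function.Construct.Symmetry using (↔-sym)
open import Function.Properties.Inverse using (↔⇒↣)
open import Relation.Binary.Definitions using (DecidableEquality)
open import Relation.Binary.PropositionalEquality
open import Relation.Nullary using (¬_; yes; no; contradiction)
open import Relation.Nullary.Decidable using (via-injection)

finite⇒≟ : ∀ {A : Set} {n} → A ↔ Fin n → DecidableEquality A
finite⇒≟ card = via-injection (↔⇒↣ card) Fin._≟_

parity≡0ℙ⇒2∣ : ∀ n → parity n ≡ 0ℙ → 2 ∣ n
parity≡0ℙ⇒2∣ zero _ = divides 0 refl
parity≡0ℙ⇒2∣ 1 ()
parity≡0ℙ⇒2∣ (suc (suc n)) even with parity≡0ℙ⇒2∣ n even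
... | divides k n≡k*2 = divides (suc k) (cong (2 ℕ.+_) n≡k*2)

even-prime≡2 : ∀ {p} → Prime p → parity p ≡ 0ℙ → p ≡ 2
even-prime≡2 {p} p-prime even with prime⇒irreducible p-prime (parity≡0ℙ⇒2∣ p even)
... | inj₁ ()
... | inj₂ 2≡p = sym 2≡p

parity-^-odd : ∀ {p} e → parity p ≡ 1ℙ → parity (p ℕ.^ e) ≡ 1ℙ
parity-^-odd zero _ = refl
parity-^-odd {p} (suc e) odd = trans (ℙ.*-homo-* p (p ℕ.^ e)) (cong₂ ℙ._*_ odd (parity-^-odd e odd))

module _ (F : Field) where
  open Field F
  open FieldDefs F
  open ≡-Reasoning

  commutativeRing : CommutativeRing 0ℓ 0ℓ
  commutativeRing = record
    { Carrier = Carrier ; _≈_ = _≡_ ; _+_ = _+_ ; _*_ = _*_ ; -_ = -_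
    ; 0# = 0# ; 1# = 1# ; isCommutativeRing = isCommutativeRing
    }

  open IsCommutativeRing isCommutativeRing
    using (+-assoc; +-identityˡ; +-identityʳ; -‿inverseˡ; -‿inverseʳ;
           *-assoc; *-comm; *-identityˡ; *-identityʳ; zeroˡ; zeroʳ)
  open CommutativeRing commutativeRing
    using (ring; semiring; commutativeSemiring; +-commutativeMonoid; *-commutativeSemigroup)
  open import Algebra.Properties.Ring ring
    using (-1*x≈-x; -‿involutive; -0#≈0#; +-identityʳ-unique; +-inverseʳ-unique)
  open import Algebra.Properties.CommutativeSemigroup *-commutativeSemigroup
    using (x∙yz≈y∙xz; xy∙z≈xz∙y)
  open import Algebra.Properties.Semiring.Mult semiring
    using (×1-homo-*) renaming (_×_ to _·_)
  open import Algebra.Properties.CommutativeMonoid.Sum +-commutativeMonoid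
    using (sum; sum-permute; sum-cong-≗; ∑-distrib-+; sum-replicate)
  import Algebra.Properties.CommutativeSemiring.Exp commutativeSemiring as Exp

  zeros : ∀ {n} → Fin n → Carrier
  zeros _ = 0#

  ^≡Exp^ : ∀ x n → x ^ n ≡ x Exp.^ n
  ^≡Exp^ x zero = refl
  ^≡Exp^ x (suc n) = cong (x *_) (^≡Exp^ x n)

  ^-distrib-* : ∀ x y n → (x * y) ^ n ≡ x ^ n * y ^ n
  ^-distrib-* x y n = begin
    (x * y) ^ n             ≡⟨ ^≡Exp^ (x * y) n ⟩
    (x * y) Exp.^ n         ≡⟨ Exp.^-distrib-* x y n ⟩
    x Exp.^ n * y Exp.^ n   ≡⟨ sym (cong₂ _*_ (^≡Exp^ x n) (^≡Exp^ y n)) ⟩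
    x ^ n * y ^ n           ∎

  ^-assocʳ : ∀ x m n → (x ^ m) ^ n ≡ x ^ (m ℕ.* n)
  ^-assocʳ x m n = begin
    (x ^ m) ^ n           ≡⟨ trans (^≡Exp^ (x ^ m) n) (cong (Exp._^ n) (^≡Exp^ x m)) ⟩
    (x Exp.^ m) Exp.^ n   ≡⟨ Exp.^-assocʳ x m n ⟩
    x Exp.^ (m ℕ.* n)     ≡⟨ sym (^≡Exp^ x (m ℕ.* n)) ⟩
    x ^ (m ℕ.* n)         ∎

  x^[q^2]≡[x^q]^q : ∀ x q → x ^ (q ℕ.^ 2) ≡ (x ^ q) ^ q
  x^[q^2]≡[x^q]^q x q = trans (cong (λ n → x ^ (q ℕ.* n)) (ℕ.*-identityʳ q)) (sym (^-assocʳ x q q))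

  1^n≡1 : ∀ n → 1# ^ n ≡ 1#
  1^n≡1 zero = refl
  1^n≡1 (suc n) = trans (*-identityˡ _) (1^n≡1 n)

  z≡0⇒c*z≡z : ∀ c {z} → z ≡ 0# → c * z ≡ z
  z≡0⇒c*z≡z c refl = zeroʳ c

  module _ {x : Carrier} (x≢0 : ¬ x ≡ 0#) where

    inv : Carrier
    inv = proj₁ (inverse x x≢0)

    [a*x]*x⁻¹≡a : ∀ a → (a * x) * inv ≡ a
    [a*x]*x⁻¹≡a a = begin
      (a * x) * inv   ≡⟨ *-assoc a x inv ⟩
      a * (x * inv)   ≡⟨ cong (a *_) (proj₂ (inverse x x≢0)) ⟩
      a * 1#          ≡⟨ *-identityʳ a ⟩
      a               ∎

    [a*x⁻¹]*x≡a : ∀ a → (a * inv) * x ≡ a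
    [a*x⁻¹]*x≡a a = trans (xy∙z≈xz∙y a inv x) ([a*x]*x⁻¹≡a a)

    x⁻¹*[a*x]≡a : ∀ a → inv * (a * x) ≡ a
    x⁻¹*[a*x]≡a a = trans (*-comm inv (a * x)) ([a*x]*x⁻¹≡a a)

    *-cancelʳ-≢0 : ∀ {a b} → a * x ≡ b * x → a ≡ b
    *-cancelʳ-≢0 {a} {b} ax≡bx = begin
      a               ≡⟨ sym ([a*x]*x⁻¹≡a a) ⟩
      (a * x) * inv   ≡⟨ cong (_* inv) ax≡bx ⟩
      (b * x) * inv   ≡⟨ [a*x]*x⁻¹≡a b ⟩
      b               ∎

  *-≢0 : ∀ {x y} → ¬ x ≡ 0# → ¬ y ≡ 0# → ¬ x * y ≡ 0#
  *-≢0 {x} {y} x≢0 y≢0 xy≡0 =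
    y≢0 (*-cancelʳ-≢0 x≢0 (trans (*-comm y x) (trans xy≡0 (sym (zeroˡ x)))))

  ^-≢0 : ∀ {x} n → ¬ x ≡ 0# → ¬ x ^ n ≡ 0#
  ^-≢0 zero _ 1≡0 = 0≢1 (sym 1≡0)
  ^-≢0 (suc n) x≢0 = *-≢0 x≢0 (^-≢0 n x≢0)

  x^n≡0⇒x≡0 : DecidableEquality Carrier → ∀ {x} n → x ^ n ≡ 0# → x ≡ 0#
  x^n≡0⇒x≡0 _≟_ {x} n xⁿ≡0 with x ≟ 0#
  ... | yes x≡0 = x≡0
  ... | no x≢0 = contradiction xⁿ≡0 (^-≢0 n x≢0)

  -1≢0 : ¬ - 1# ≡ 0#
  -1≢0 -1≡0 = 0≢1 (sym (begin
    1#        ≡⟨ sym (-‿involutive 1#) ⟩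
    - (- 1#)  ≡⟨ cong -_ -1≡0 ⟩
    - 0#      ≡⟨ -0#≈0# ⟩
    0#        ∎))

  [-1]^n≡-1 : ∀ n → parity n ≡ 1ℙ → (- 1#) ^ n ≡ - 1#
  [-1]^n≡-1 zero ()
  [-1]^n≡-1 1 _ = *-identityʳ (- 1#)
  [-1]^n≡-1 (suc (suc n)) odd = begin
    - 1# * (- 1# * (- 1#) ^ n)   ≡⟨ sym (*-assoc (- 1#) (- 1#) _) ⟩
    (- 1# * - 1#) * (- 1#) ^ n   ≡⟨ cong₂ _*_ -1*-1≡1 ([-1]^n≡-1 n odd) ⟩
    1# * - 1#                    ≡⟨ *-identityˡ (- 1#) ⟩
    - 1#                         ∎
    where
    -1*-1≡1 : - 1# * - 1# ≡ 1#
    -1*-1≡1 = trans (-1*x≈-x (- 1#)) (-‿involutive 1#)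

  card·x≡0 : ∀ {n} → Carrier ↔ Fin n → ∀ x → n · x ≡ 0#
  card·x≡0 {n} card x = +-identityʳ-unique (sum elements) (n · x) (begin
    sum elements + n · x                     ≡⟨ cong (sum elements +_) (sym (sum-replicate n)) ⟩
    sum elements + sum {n} (λ _ → x)         ≡⟨ sym (∑-distrib-+ elements (λ _ → x)) ⟩
    sum (λ i → elements i + x)               ≡⟨ sum-cong-≗ {n} (λ i → sym (from-to _)) ⟩
    sum (elements ∘ Inverse.to translation)  ≡⟨ sym (sum-permute elements translation) ⟩
    sum elements                             ∎)
    where
    open Inverse card using (from) renaming (strictlyInverseʳ to from-to)

    elements : Fin n → Carrier
    elements = from

    shift : Carrier ↔ Carrier
    shift = mk↔ₛ′ (_+ x) (_+ - x)
      (λ y → trans (+-assoc y (- x) x) (trans (cong (y +_) (-‿inverseˡ x)) (+-identityʳ y)))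
      (λ y → trans (+-assoc y x (- x)) (trans (cong (y +_) (-‿inverseʳ x)) (+-identityʳ y)))

    translation : Fin n ↔ Fin n
    translation = card ↔-∘ (shift ↔-∘ ↔-sym card)

  [m^n]·1≡[m·1]^n : ∀ m n → (m ℕ.^ n) · 1# ≡ (m · 1#) ^ n
  [m^n]·1≡[m·1]^n m zero = +-identityʳ 1#
  [m^n]·1≡[m·1]^n m (suc n) =
    trans (×1-homo-* m (m ℕ.^ n)) (cong ((m · 1#) *_) ([m^n]·1≡[m·1]^n m n))

  [m^n]·1≡0⇒m·1≡0 : DecidableEquality Carrier → ∀ m n → (m ℕ.^ n) · 1# ≡ 0# → m · 1# ≡ 0#
  [m^n]·1≡0⇒m·1≡0 _≟_ m n mⁿ·1≡0 =
    x^n≡0⇒x≡0 _≟_ n (trans (sym ([m^n]·1≡[m·1]^n m n)) mⁿ·1≡0)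

  primePower⇒-1∈Fq : ∀ {q} m → IsPrimePower q → Carrier ↔ Fin (q ℕ.^ m) → InFq q (- 1#)
  primePower⇒-1∈Fq m (p , e , p-prime , _ , refl) card with parity p in p-parity
  ... | 1ℙ = [-1]^n≡-1 (p ℕ.^ e) (parity-^-odd e p-parity)
  ... | 0ℙ = begin
    (- 1#) ^ (p ℕ.^ e)   ≡⟨ cong (_^ (p ℕ.^ e)) -1≡1 ⟩
    1# ^ (p ℕ.^ e)       ≡⟨ 1^n≡1 (p ℕ.^ e) ⟩
    1#                   ≡⟨ sym -1≡1 ⟩
    - 1#                 ∎
    where
    _≟_ : DecidableEquality Carrier
    _≟_ = finite⇒≟ card
    p·1≡0 : p · 1# ≡ 0#
    p·1≡0 = [m^n]·1≡0⇒m·1≡0 _≟_ p e ([m^n]·1≡0⇒m·1≡0 _≟_ (p ℕ.^ e) m (card·x≡0 card 1#))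
    -1≡1 : - 1# ≡ 1#
    -1≡1 = sym (+-inverseʳ-unique 1# 1# (begin
      1# + 1#          ≡⟨ cong (1# +_) (sym (+-identityʳ 1#)) ⟩
      2 · 1#           ≡⟨ cong (_· 1#) (sym (even-prime≡2 p-prime p-parity)) ⟩
      p · 1#           ≡⟨ p·1≡0 ⟩
      0#               ∎))

  primePower⇒0∈Fq : ∀ {q} → IsPrimePower q → InFq q 0#
  primePower⇒0∈Fq (p , e , p-prime , _ , refl) =
    0^n≡0 (p ℕ.^ e) {{ℕ.m^n≢0 p e {{prime⇒nonZero p-prime}}}}
    where
    0^n≡0 : ∀ n → .{{NonZero n}} → 0# ^ n ≡ 0#
    0^n≡0 (suc n) = zeroˡ _

  sumF-≡0 : ∀ {d} (f : Fin d → Carrier) → (∀ i → f i ≡ 0#) → sumF f ≡ 0#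
  sumF-≡0 {zero} f _ = refl
  sumF-≡0 {suc d} f f≡0 =
    trans (cong₂ _+_ (f≡0 zero) (sumF-≡0 (f ∘ suc) (f≡0 ∘ suc))) (+-identityʳ 0#)

  idᴬ : Automorphism
  idᴬ = record { bij = ↔-id Carrier ; to-+ = λ _ _ → refl ; to-* = λ _ _ → refl ; to-1 = refl }

  module AutomorphismProperties (σ : Automorphism) where
    open Automorphism σ

    to-injective : ∀ {x y} → to x ≡ to y → x ≡ y
    to-injective = Injection.injective (↔⇒↣ bij)

    to-^ : ∀ x n → to (x ^ n) ≡ to x ^ n
    to-^ x zero = to-1
    to-^ x (suc n) = trans (to-* x (x ^ n)) (cong (to x *_) (to-^ x n))

    private
      from : Carrier → Carrier
      from = Inverse.from bij

      from-homo : (_∙_ : Op₂ Carrier) → (∀ x y → to (x ∙ y) ≡ to x ∙ to y) →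
        ∀ x y → from (x ∙ y) ≡ from x ∙ from y
      from-homo _∙_ to-∙ x y = to-injective (begin
        to (from (x ∙ y))          ≡⟨ Inverse.strictlyInverseˡ bij (x ∙ y) ⟩
        x ∙ y                      ≡⟨ sym (cong₂ _∙_ (Inverse.strictlyInverseˡ bij x)
                                                     (Inverse.strictlyInverseˡ bij y)) ⟩
        to (from x) ∙ to (from y)  ≡⟨ sym (to-∙ (from x) (from y)) ⟩
        to (from x ∙ from y)       ∎)

    inverseᴬ : Automorphism
    inverseᴬ = record
      { bij = ↔-sym bij
      ; to-+ = from-homo _+_ to-+
      ; to-* = from-homo _*_ to-*
      ; to-1 = to-injective (trans (Inverse.strictlyInverseˡ bij 1#) (sym to-1))
      }

  module _ (q : ℕ) where

    InSpan : Carrier → Carrier → Set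
    InSpan b x = ∃[ c ] (InFq q c × x ≡ c * b)

    SpannedBy : (Carrier → Set) → Carrier → Set
    SpannedBy S b = ∀ x → (S x → InSpan b x) × (InSpan b x → S x)

    LinearlyIndependent : ∀ {d} → (Fin d → Carrier) → Set
    LinearlyIndependent {d} b = ∀ (c : Fin d → Carrier) → (∀ i → InFq q (c i)) →
      sumF (λ i → c i * b i) ≡ 0# → ∀ i → c i ≡ 0#

    independent⇒head≢0 : ∀ {d} {b : Fin (suc d) → Carrier} → InFq q 0# →
      LinearlyIndependent b → ¬ b zero ≡ 0#
    independent⇒head≢0 {b = b} 0∈Fq independent b₀≡0 =
      0≢1 (sym (independent c c∈Fq Σc*b≡0 zero))
      where
      c : Fin _ → Carrier
      c zero = 1#
      c (suc _) = 0#
      c∈Fq : ∀ i → InFq q (c i)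
      c∈Fq zero = 1^n≡1 q
      c∈Fq (suc _) = 0∈Fq
      Σc*b≡0 : sumF (λ i → c i * b i) ≡ 0#
      Σc*b≡0 = trans (cong₂ _+_ (trans (*-identityˡ _) b₀≡0) (sumF-≡0 _ (zeroˡ ∘ b ∘ suc)))
                     (+-identityʳ 0#)

    independent⇒¬InSpan : ∀ {d} {b : Fin (suc (suc d)) → Carrier} → InFq q 0# → InFq q (- 1#) →
      LinearlyIndependent b → ¬ InSpan (b zero) (b (suc zero))
    independent⇒¬InSpan {b = b} 0∈Fq -1∈Fq independent (r , r∈Fq , b₁≡rb₀) =
      -1≢0 (independent c c∈Fq Σc*b≡0 (suc zero))
      where
      c : Fin _ → Carrier
      c zero = r
      c (suc zero) = - 1#
      c (suc (suc _)) = 0#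
      c∈Fq : ∀ i → InFq q (c i)
      c∈Fq zero = r∈Fq
      c∈Fq (suc zero) = -1∈Fq
      c∈Fq (suc (suc _)) = 0∈Fq
      Σc*b≡0 : sumF (λ i → c i * b i) ≡ 0#
      Σc*b≡0 = begin
        r * b zero + (- 1# * b (suc zero) + sumF (λ i → 0# * b (suc (suc i))))
          ≡⟨ cong₂ _+_ (sym b₁≡rb₀)
                       (cong₂ _+_ (-1*x≈-x _) (sumF-≡0 _ (λ i → zeroˡ (b (suc (suc i)))))) ⟩
        b (suc zero) + (- b (suc zero) + 0#)   ≡⟨ cong (b (suc zero) +_) (+-identityʳ _) ⟩
        b (suc zero) + - b (suc zero)          ≡⟨ -‿inverseʳ _ ⟩
        0#                                     ∎

    dimension0⇒spannedBy0 : ∀ {S} → IsSubspace q S → HasDimension q S 0 → SpannedBy S 0#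
    dimension0⇒spannedBy0 {S} S-sub (_ , _ , _ , span) x =
      (λ Sx → 1# , 1^n≡1 q , trans (sym (proj₂ (proj₂ (span x Sx)))) (sym (zeroʳ 1#))) ,
      (λ (c , _ , x≡c*0) → subst S (sym (trans x≡c*0 (zeroʳ c))) (IsSubspace.zero∈ S-sub))

    dimension1⇒spannedBy : ∀ {S} → IsSubspace q S → (S-dim : HasDimension q S 1) →
      SpannedBy S (proj₁ S-dim zero)
    dimension1⇒spannedBy {S} S-sub (b , S-b , _ , span) x =
      (λ Sx → let c , c∈Fq , Σc*b≡x = span x Sx in
              c zero , c∈Fq zero , trans (sym Σc*b≡x) (+-identityʳ _)) ,
      (λ (c , c∈Fq , x≡c*b₀) →
         subst S (sym x≡c*b₀) (IsSubspace.scale-closed S-sub c∈Fq (S-b zero)))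

    spannedBy⇒IsImageOf : ∀ {S T b b′ α} → SpannedBy S b → SpannedBy T b′ → b ≡ α * b′ →
      IsImageOf S α idᴬ T
    spannedBy⇒IsImageOf {S = S} {T} {b} {b′} {α} S-span T-span b≡αb′ x = fwd , bwd
      where
      fwd : S x → ∃[ t ] (T t × x ≡ α * t)
      fwd Sx = let c , c∈Fq , x≡cb = proj₁ (S-span x) Sx in
        c * b′ , proj₂ (T-span (c * b′)) (c , c∈Fq , refl) , (begin
          x              ≡⟨ x≡cb ⟩
          c * b          ≡⟨ cong (c *_) b≡αb′ ⟩
          c * (α * b′)   ≡⟨ x∙yz≈y∙xz c α b′ ⟩
          α * (c * b′)   ∎)
      bwd : ∃[ t ] (T t × x ≡ α * t) → S x
      bwd (t , Tt , x≡αt) = let c , c∈Fq , t≡cb′ = proj₁ (T-span t) Tt in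
        proj₂ (S-span x) (c , c∈Fq , (begin
          x              ≡⟨ x≡αt ⟩
          α * t          ≡⟨ cong (α *_) t≡cb′ ⟩
          α * (c * b′)   ≡⟨ x∙yz≈y∙xz α c b′ ⟩
          c * (α * b′)   ≡⟨ cong (c *_) (sym b≡αb′) ⟩
          c * b          ∎))

    dimension0⇒similar : ∀ {S T} → IsSubspace q S → HasDimension q S 0 →
      IsSubspace q T → HasDimension q T 0 → ∃[ α ] ∃[ σ ] IsImageOf S α σ T
    dimension0⇒similar S-sub S-dim T-sub T-dim =
      1# , idᴬ , spannedBy⇒IsImageOf (dimension0⇒spannedBy0 S-sub S-dim)
                                     (dimension0⇒spannedBy0 T-sub T-dim) (sym (zeroʳ 1#))

    dimension1⇒similar : ∀ {S T} → InFq q 0# → IsSubspace q S → HasDimension q S 1 →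
      IsSubspace q T → HasDimension q T 1 → ∃[ α ] ∃[ σ ] IsImageOf S α σ T
    dimension1⇒similar 0∈Fq S-sub S-dim@(b , _) T-sub T-dim@(b′ , _ , b′-independent , _) =
      b zero * inv b′₀≢0 , idᴬ ,
      spannedBy⇒IsImageOf (dimension1⇒spannedBy S-sub S-dim) (dimension1⇒spannedBy T-sub T-dim)
                          (sym ([a*x⁻¹]*x≡a b′₀≢0 (b zero)))
      where
      b′₀≢0 : ¬ b′ zero ≡ 0#
      b′₀≢0 = independent⇒head≢0 {b = b′} 0∈Fq b′-independent

    frobPairs-cong : ∀ n {x y : Fin n → Carrier} → (∀ i → x i ≡ y i) →
      frobPairs q n x ≡ frobPairs q n y
    frobPairs-cong zero _ = refl
    frobPairs-cong (suc n) x≗y =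
      cong₂ _∷_ (x≗y zero) (cong₂ _∷_ (cong (_^ q) (x≗y zero)) (frobPairs-cong n (x≗y ∘ suc)))

    uBarVec-cong : ∀ s (s≥1 : 1 ≤ s) ζ {x y : Fin s → Carrier} → (∀ i → x i ≡ y i) →
      uBarVec q s s≥1 ζ x ≡ uBarVec q s s≥1 ζ y
    uBarVec-cong (suc s) _ ζ x≗y =
      cong₂ _∷_ (cong (_+ ζ) (x≗y zero)) (cong₂ _∷_ (cong (_^ q) (x≗y zero))
        (cong₂ _∷_ (cong (_^ (q ℕ.^ 2)) (x≗y zero)) (frobPairs-cong s (x≗y ∘ suc))))

    scale-frobPairs-zeros : InFq q 0# → ∀ n c →
      map (c *_) (frobPairs q n zeros) ≡ frobPairs q n zeros
    scale-frobPairs-zeros 0∈Fq zero c = refl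
    scale-frobPairs-zeros 0∈Fq (suc n) c =
      cong₂ _∷_ (zeroʳ c) (cong₂ _∷_ (z≡0⇒c*z≡z c 0∈Fq) (scale-frobPairs-zeros 0∈Fq n c))

    [μa]^q≡μa^q⇒μ∈Fq : ∀ {μ a} → ¬ a ≡ 0# → (μ * a) ^ q ≡ μ * a ^ q → InFq q μ
    [μa]^q≡μa^q⇒μ∈Fq {μ} {a} a≢0 [μa]^q≡μa^q =
      *-cancelʳ-≢0 (^-≢0 q a≢0) (trans (sym (^-distrib-* μ a q)) [μa]^q≡μa^q)

    scaled-frobPairs⇒∈Fq : ∀ {μ} n (x y : Fin n → Carrier) →
      frobPairs q n y ≡ map (μ *_) (frobPairs q n x) → ∀ j → ¬ x j ≡ 0# → InFq q μ
    scaled-frobPairs⇒∈Fq {μ} (suc n) x y y≡μx zero x₀≢0 = [μa]^q≡μa^q⇒μ∈Fq x₀≢0 (begin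
      (μ * x zero) ^ q   ≡⟨ cong (_^ q) (sym (∷-injectiveˡ y≡μx)) ⟩
      y zero ^ q         ≡⟨ ∷-injectiveˡ (∷-injectiveʳ y≡μx) ⟩
      μ * x zero ^ q     ∎)
    scaled-frobPairs⇒∈Fq (suc n) x y y≡μx (suc j) =
      scaled-frobPairs⇒∈Fq n (x ∘ suc) (y ∘ suc) (∷-injectiveʳ (∷-injectiveʳ y≡μx)) j

    scaled-uBarVec⇒∈Fq : ∀ {μ ζ ζ′} s (s≥1 : 1 ≤ s) (x y : Fin s → Carrier) →
      uBarVec q s s≥1 ζ′ y ≡ map (μ *_) (uBarVec q s s≥1 ζ x) → ∀ j → ¬ x j ≡ 0# → InFq q μ
    scaled-uBarVec⇒∈Fq {μ} (suc s) _ x y y≡μx zero x₀≢0 =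
      [μa]^q≡μa^q⇒μ∈Fq (^-≢0 q x₀≢0) (begin
      (μ * x zero ^ q) ^ q       ≡⟨ cong (_^ q) (sym (∷-injectiveˡ (∷-injectiveʳ y≡μx))) ⟩
      (y zero ^ q) ^ q           ≡⟨ sym (x^[q^2]≡[x^q]^q (y zero) q) ⟩
      y zero ^ (q ℕ.^ 2)         ≡⟨ ∷-injectiveˡ (∷-injectiveʳ (∷-injectiveʳ y≡μx)) ⟩
      μ * x zero ^ (q ℕ.^ 2)     ≡⟨ cong (μ *_) (x^[q^2]≡[x^q]^q (x zero) q) ⟩
      μ * (x zero ^ q) ^ q       ∎)
    scaled-uBarVec⇒∈Fq (suc s) _ x y y≡μx (suc j) =
      scaled-frobPairs⇒∈Fq s (x ∘ suc) (y ∘ suc) (∷-injectiveʳ (∷-injectiveʳ (∷-injectiveʳ y≡μx))) j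

    module ΓL-Equivalence {s : ℕ} (0∈Fq : InFq q 0#) (_≟_ : DecidableEquality Carrier)
      {S T : Carrier → Set}
      (equiv : ΓL-Equivalent (suc (double (suc s))) (U q (suc s) S) (UBar q (suc s) (s≤s z≤n) T))
      where

      open SemilinearBijection (proj₁ equiv)
        using (semilinear) renaming (σ to σᴬ; to to Φ; bij to Φ-bij)
      open AutomorphismProperties σᴬ using (to-injective; to-^; inverseᴬ)

      σ : Carrier → Carrier
      σ = Automorphism.to σᴬ

      σ-* : ∀ x y → σ (x * y) ≡ σ x * σ y
      σ-* = Automorphism.to-* σᴬ

      Point : Set
      Point = Vec Carrier (suc (double (suc s)))

      U-S Ū-T : Point → Set
      U-S = U q (suc s) S
      Ū-T = UBar q (suc s) (s≤s z≤n) T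

      ū : Carrier → (Fin (suc s) → Carrier) → Point
      ū = uBarVec q (suc s) (s≤s z≤n)

      ū₀ : Carrier → Point
      ū₀ ζ = ū ζ zeros

      axis : Carrier → Point
      axis η = uVec q (suc s) η zeros

      Φ-injective : ∀ {v w} → Φ v ≡ Φ w → v ≡ w
      Φ-injective = Injection.injective (↔⇒↣ Φ-bij)

      Φ-axis∈Ū : ∀ {η} → S η → Ū-T (Φ (axis η))
      Φ-axis∈Ū {η} Sη = proj₂ (proj₂ equiv (Φ (axis η))) (axis η , (η , zeros , Sη , refl) , refl)

      Ū⊆Φ[U] : ∀ {w} → Ū-T w → ∃[ v ] (U-S v × w ≡ Φ v)
      Ū⊆Φ[U] {w} = proj₁ (proj₂ equiv w)

      Φ-axis-* : ∀ c η → Φ (axis (c * η)) ≡ map (σ c *_) (Φ (axis η))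
      Φ-axis-* c η = trans (cong (Φ ∘ (c * η ∷_)) (sym (scale-frobPairs-zeros 0∈Fq (suc s) c)))
                           (semilinear c (axis η))

      scale-ū₀ : ∀ c ζ → map (c *_) (ū₀ ζ) ≡ ū₀ (c * ζ)
      scale-ū₀ c ζ =
        cong₂ _∷_ (trans (cong (c *_) (+-identityˡ ζ)) (sym (+-identityˡ (c * ζ))))
          (cong₂ _∷_ (z≡0⇒c*z≡z c 0∈Fq)
            (cong₂ _∷_ (z≡0⇒c*z≡z c 0^[q^2]≡0) (scale-frobPairs-zeros 0∈Fq s c)))
        where
        0^[q^2]≡0 : 0# ^ (q ℕ.^ 2) ≡ 0#
        0^[q^2]≡0 = trans (x^[q^2]≡[x^q]^q 0# q) (trans (cong (_^ q) 0∈Fq) 0∈Fq)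

      ū₀≡ū⇒offset≡ : ∀ {a ζ} y → ū₀ a ≡ ū ζ y → a ≡ ζ
      ū₀≡ū⇒offset≡ {a} {ζ} y ū₀a≡ūζy = begin
        a            ≡⟨ sym (+-identityˡ a) ⟩
        0# + a       ≡⟨ ∷-injectiveˡ ū₀a≡ūζy ⟩
        y zero + ζ   ≡⟨ cong (_+ ζ) y₀≡0 ⟩
        0# + ζ       ≡⟨ +-identityˡ ζ ⟩
        ζ            ∎
        where
        y₀≡0 : y zero ≡ 0#
        y₀≡0 = x^n≡0⇒x≡0 _≟_ q (trans (sym (∷-injectiveˡ (∷-injectiveʳ ū₀a≡ūζy))) 0∈Fq)

      nonzero-tail⇒InSpan : ∀ {b ζ₀ x} → ¬ b ≡ 0# → Φ (axis b) ≡ ū ζ₀ x →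
        (Σ[ j ∈ Fin (suc s) ] ¬ x j ≡ 0#) → ∀ {η} → S η → InSpan b η
      nonzero-tail⇒InSpan {b} {ζ₀} {x} b≢0 Φ-axis-b (j , xⱼ≢0) {η} Sη =
        let ζ , y , _ , Φ-axis-η = Φ-axis∈Ū Sη
            r = η * inv b≢0
            ūζy≡σr·ūζ₀x : ū ζ y ≡ map (σ r *_) (ū ζ₀ x)
            ūζy≡σr·ūζ₀x = begin
              ū ζ y                        ≡⟨ sym Φ-axis-η ⟩
              Φ (axis η)                   ≡⟨ cong (Φ ∘ axis) (sym ([a*x⁻¹]*x≡a b≢0 η)) ⟩
              Φ (axis (r * b))             ≡⟨ Φ-axis-* r b ⟩
              map (σ r *_) (Φ (axis b))    ≡⟨ cong (map (σ r *_)) Φ-axis-b ⟩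
              map (σ r *_) (ū ζ₀ x)        ∎
            σr∈Fq = scaled-uBarVec⇒∈Fq (suc s) (s≤s z≤n) x y ūζy≡σr·ūζ₀x j xⱼ≢0
        in r , to-injective (trans (to-^ r q) σr∈Fq) , sym ([a*x⁻¹]*x≡a b≢0 η)

      Φ-axis≡ū₀⇒similar : ∀ c → (∀ η → Φ (axis η) ≡ ū₀ (σ η * c)) → ∃[ α ] ∃[ τ ] IsImageOf S α τ T
      Φ-axis≡ū₀⇒similar c Φ-axis = τ c⁻¹ , inverseᴬ , image
        where
        c≢0 : ¬ c ≡ 0#
        c≢0 c≡0 = 0≢1 (∷-injectiveˡ (Φ-injective (trans (Φ-axis≡ū₀0 0#) (sym (Φ-axis≡ū₀0 1#)))))
          where
          Φ-axis≡ū₀0 : ∀ η → Φ (axis η) ≡ ū₀ 0#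
          Φ-axis≡ū₀0 η = trans (Φ-axis η) (cong ū₀ (trans (cong (σ η *_) c≡0) (zeroʳ (σ η))))

        c⁻¹ : Carrier
        c⁻¹ = inv c≢0

        τ : Carrier → Carrier
        τ = Automorphism.to inverseᴬ

        σ∘τ : ∀ x → σ (τ x) ≡ x
        σ∘τ = Inverse.strictlyInverseˡ (Automorphism.bij σᴬ)

        τ∘σ : ∀ x → τ (σ x) ≡ x
        τ∘σ = Inverse.strictlyInverseʳ (Automorphism.bij σᴬ)

        image : IsImageOf S (τ c⁻¹) inverseᴬ T
        image η = fwd , bwd
          where
          fwd : S η → ∃[ t ] (T t × η ≡ τ c⁻¹ * τ t)
          fwd Sη =
            let ζ , y , Tζ , Φ-axis-η = Φ-axis∈Ū Sη
                σηc≡ζ = ū₀≡ū⇒offset≡ y (trans (sym (Φ-axis η)) Φ-axis-η)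
            in ζ , Tζ , (begin
              η                      ≡⟨ sym (τ∘σ η) ⟩
              τ (σ η)                ≡⟨ cong τ (sym (x⁻¹*[a*x]≡a c≢0 (σ η))) ⟩
              τ (c⁻¹ * (σ η * c))    ≡⟨ Automorphism.to-* inverseᴬ c⁻¹ (σ η * c) ⟩
              τ c⁻¹ * τ (σ η * c)    ≡⟨ cong ((τ c⁻¹ *_) ∘ τ) σηc≡ζ ⟩
              τ c⁻¹ * τ ζ            ∎)

          bwd : ∃[ t ] (T t × η ≡ τ c⁻¹ * τ t) → S η
          bwd (t , Tt , η≡τc⁻¹τt) =
            let v , (η′ , _ , Sη′ , v≡uη′) , ū₀t≡Φv = Ū⊆Φ[U] (t , zeros , Tt , refl)
                axis-η≡v = Φ-injective (trans Φ-axis-η ū₀t≡Φv)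
            in subst S (sym (∷-injectiveˡ (trans axis-η≡v v≡uη′))) Sη′
            where
            Φ-axis-η : Φ (axis η) ≡ ū₀ t
            Φ-axis-η = begin
              Φ (axis η)                       ≡⟨ Φ-axis η ⟩
              ū₀ (σ η * c)                     ≡⟨ cong (λ e → ū₀ (σ e * c)) η≡τc⁻¹τt ⟩
              ū₀ (σ (τ c⁻¹ * τ t) * c)         ≡⟨ cong (λ e → ū₀ (e * c)) (σ-* (τ c⁻¹) (τ t)) ⟩
              ū₀ ((σ (τ c⁻¹) * σ (τ t)) * c)   ≡⟨ cong₂ (λ a b → ū₀ (a * b * c)) (σ∘τ c⁻¹) (σ∘τ t) ⟩
              ū₀ ((c⁻¹ * t) * c)               ≡⟨ cong ū₀ (*-assoc c⁻¹ t c) ⟩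
              ū₀ (c⁻¹ * (t * c))               ≡⟨ cong ū₀ (x⁻¹*[a*x]≡a c≢0 t) ⟩
              ū₀ t                             ∎

      similar⊎InSpan : ∀ {b} → S b → ¬ b ≡ 0# →
        (∃[ α ] ∃[ τ ] IsImageOf S α τ T) ⊎ (∀ {η} → S η → InSpan b η)
      similar⊎InSpan {b} Sb b≢0 with Φ-axis∈Ū Sb
      ... | ζ₀ , x , _ , Φ-axis-b with all? (λ j → x j ≟ 0#)
      ...   | no x≢0 = inj₂ (nonzero-tail⇒InSpan b≢0 Φ-axis-b (¬∀⟶∃¬ _ _ (λ j → x j ≟ 0#) x≢0))
      ...   | yes x≡0 = inj₁ (Φ-axis≡ū₀⇒similar (σ b⁻¹ * ζ₀) Φ-axis)
        where
        b⁻¹ : Carrier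
        b⁻¹ = inv b≢0

        Φ-axis-b₀ : Φ (axis b) ≡ ū₀ ζ₀
        Φ-axis-b₀ = trans Φ-axis-b (uBarVec-cong (suc s) (s≤s z≤n) ζ₀ x≡0)

        Φ-axis : ∀ η → Φ (axis η) ≡ ū₀ (σ η * (σ b⁻¹ * ζ₀))
        Φ-axis η = begin
          Φ (axis η)                          ≡⟨ cong (Φ ∘ axis) (sym ([a*x⁻¹]*x≡a b≢0 η)) ⟩
          Φ (axis ((η * b⁻¹) * b))            ≡⟨ Φ-axis-* (η * b⁻¹) b ⟩
          map (σ (η * b⁻¹) *_) (Φ (axis b))   ≡⟨ cong (map (σ (η * b⁻¹) *_)) Φ-axis-b₀ ⟩
          map (σ (η * b⁻¹) *_) (ū₀ ζ₀)        ≡⟨ scale-ū₀ (σ (η * b⁻¹)) ζ₀ ⟩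
          ū₀ (σ (η * b⁻¹) * ζ₀)               ≡⟨ cong (λ e → ū₀ (e * ζ₀)) (σ-* η b⁻¹) ⟩
          ū₀ ((σ η * σ b⁻¹) * ζ₀)             ≡⟨ cong ū₀ (*-assoc (σ η) (σ b⁻¹) ζ₀) ⟩
          ū₀ (σ η * (σ b⁻¹ * ζ₀))             ∎

-- Imported only now: in the development above, _^_ is the power in the field (FieldDefs._^_).
open import Data.Nat using (_^_)

corollary5p14 : (q m s : ℕ) → IsPrimePower q → 1 ≤ m → (s≥1 : 1 ≤ s) →
    (F : Field) → FieldDefs.HasCardinality F (q ^ m) →
    (S T : Field.Carrier F → Set) →
    FieldDefs.IsSubspace F q S → FieldDefs.HasDimension F q S (m ∸ 2) →
    FieldDefs.IsSubspace F q T → FieldDefs.HasDimension F q T (m ∸ 2) →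
    ¬ (∃[ α ] ∃[ σ ] FieldDefs.IsImageOf F S α σ T) →
    ¬ FieldDefs.ΓL-Equivalent F (suc (double s))
        (FieldDefs.U F q s S) (FieldDefs.UBar F q s s≥1 T)
corollary5p14 q m (suc s) q-prime-power _ (s≤s z≤n) F card S T S-sub S-dim T-sub T-dim not-similar =
  inequivalent (m ∸ 2) S-dim T-dim
  where
  open Field F using (0#; -_; 1#)
  open FieldDefs F using (InFq; HasDimension; ΓL-Equivalent; U; UBar)

  0∈Fq : InFq q 0#
  0∈Fq = primePower⇒0∈Fq F q-prime-power

  -1∈Fq : InFq q (- 1#)
  -1∈Fq = primePower⇒-1∈Fq F m q-prime-power card

  inequivalent : ∀ d → HasDimension q S d → HasDimension q T d →
    ¬ ΓL-Equivalent (suc (double (suc s))) (U q (suc s) S) (UBar q (suc s) (s≤s z≤n) T)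
  inequivalent 0 S-dim₀ T-dim₀ _ =
    not-similar (dimension0⇒similar F q S-sub S-dim₀ T-sub T-dim₀)
  inequivalent 1 S-dim₁ T-dim₁ _ =
    not-similar (dimension1⇒similar F q 0∈Fq S-sub S-dim₁ T-sub T-dim₁)
  inequivalent (suc (suc _)) (b , S-b , b-independent , _) _ equiv
    with ΓL-Equivalence.similar⊎InSpan F q 0∈Fq (finite⇒≟ card) equiv (S-b zero)
           (independent⇒head≢0 F q {b = b} 0∈Fq b-independent)
  ... | inj₁ similar = not-similar similar
  ... | inj₂ S⊆Fq·b₀ =
    independent⇒¬InSpan F q {b = b} 0∈Fq -1∈Fq b-independent (S⊆Fq·b₀ (S-b (suc zero)))
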